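{- Let $F$ be a graph with a cut-vertex $v$, and let $G^1,G^2,\dots,G^m$ be all the $v$-components of $F$. If $k$ is an integer with $2\leq k<\min\{\delta(G^i)\mid 1\leq i\leq m\}$, then \[ \sum_{i=1}^m \gamma_{\times k,t}(G^i_I)-m(k+1)+k\leq \gamma_{\times k,t}(F_I)\leq \sum_{i=1}^m\gamma_{\times k,t}(G^i_I). \] Moreover, the upper bound $\sum_{i=1}^m\gamma_{\times k,t}(G^i_I)$ is sharp, i.e. it is attained (with equality) by some such graphs $F$.
   Context: All graphs are finite, simple and undirected. A vertex $v$ of a connected graph $F$ is a cut-vertex if $F-v$ is disconnected. If $S$ is the vertex set of a connected component of $F-v$, the subgraph of $F$ induced by $S\cup\{v\}$ is called a $v$-component of $F$. For a graph $G$ without isolated vertices, the inflated graph $G_I$ is obtained as follows: each vertex $x_i$ of $G$ of degree $d(x_i)$ is replaced by a clique $X_i\cong K_{d(x_i)}$ whose vertices are labelled $x_ix_j$, one for each neighbour $x_j$ of $x_i$; and each edge $x_ix_j$ of $G$ is replaced by the edge joining $x_ix_j\in X_i$ to $x_jx_i\in X_j$. For an integer $k\geq1$, a set $S\subseteq V(H)$ is a $k$-tuple total dominating set of a graph $H$ if every vertex of $H$ has at least $k$ neighbours in $S$; $\gamma_{\times k,t}(H)$ denotes the minimum cardinality of such a set. -}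

module Defs where

open import Data.Nat using (ℕ; zero; suc; _+_; _*_; _≤_; _<_)
open import Data.Fin using (Fin)
import Data.Fin as Fin
import Data.Fin.Properties as FinP
open import Data.Bool using (Bool; true; false; _∧_; _∨_; not; T)
open import Data.Unit using (tt)
open import Data.Product using (Σ; Σ-syntax; ∃; ∃-syntax; _×_; _,_; proj₁; proj₂)
import Data.Product.Properties as ProdP
open import Data.List using (List; []; _∷_; length; allFin)
open import Data.List.Relation.Unary.Unique.Propositional using (Unique)
open import Relation.Binary.PropositionalEquality using (_≡_; _≢_; refl)
open import Relation.Binary.Definitions using (DecidableEquality)
open import Relation.Nullary using (¬_; yes; no)
open import Relation.Nullary.Decidable using (⌊_⌋)

record SimpleGraph (n : ℕ) : Set where
  field
    adj    : Fin n → Fin n → Bool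
    sym    : ∀ x y → adj x y ≡ adj y x
    irrefl : ∀ x → adj x x ≡ false
open SimpleGraph public

-- Used for induced subgraphs and inflated
-- graphs (all the ones we build are finite simple graphs).

record Gr : Set₁ where
  field
    V   : Set
    dec : DecidableEquality V
    E   : V → V → Bool
open Gr public

T-dec : ∀ {b} → DecidableEquality (T b)
T-dec {true} tt tt = yes refl

AsGr : ∀ {n} → SimpleGraph n → Gr
AsGr {n} F = record { V = Fin n ; dec = FinP._≟_ ; E = adj F }

Induced : ∀ {n} → SimpleGraph n → (Fin n → Bool) → Gr
Induced {n} F P = record
  { V   = Σ (Fin n) (λ x → T (P x))
  ; dec = ProdP.≡-dec FinP._≟_ T-dec
  ; E   = λ x y → adj F (proj₁ x) (proj₁ y) }

-- Inflated graph G_I: vertices are the ordered pairs (xi , xj) with xi xj an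
-- edge of G (the vertex "xi xj" of the clique X_i).  Two of them are adjacent
-- iff they lie in the same clique X_i (same first coordinate, distinct second
-- coordinates), or they are xi xj and xj xi (the edge replacing xi xj).

IV : Gr → Set
IV G = Σ (V G × V G) (λ p → T (E G (proj₁ p) (proj₂ p)))

IE : (G : Gr) → IV G → IV G → Bool
IE G ((a , b) , _) ((c , d) , _) =
  (⌊ dec G a c ⌋ ∧ not ⌊ dec G b d ⌋) ∨ (⌊ dec G a d ⌋ ∧ ⌊ dec G b c ⌋)

Inflate : Gr → Gr
Inflate G = record
  { V   = IV G
  ; dec = ProdP.≡-dec (ProdP.≡-dec (dec G) (dec G)) T-dec
  ; E   = IE G }

count : {A : Set} → (A → Bool) → List A → ℕ
count p []       = 0
count p (x ∷ xs) with p x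
... | true  = suc (count p xs)
... | false = count p xs

-- S (a duplicate-free list of vertices, i.e. a finite vertex set) is a
-- k-tuple total dominating set of H: every vertex has >= k neighbours in S
IsKTupleTDS : (H : Gr) → ℕ → List (V H) → Set
IsKTupleTDS H k S = Unique S × (∀ x → k ≤ count (E H x) S)

IsGammaKT : (H : Gr) → ℕ → ℕ → Set
IsGammaKT H k c =
  (Σ[ S ∈ List (V H) ] IsKTupleTDS H k S × length S ≡ c)
  × (∀ S → IsKTupleTDS H k S → c ≤ length S)

data Walk {n} (F : SimpleGraph n) (P : Fin n → Bool) : Fin n → Fin n → Set where
  stay : ∀ {x} → T (P x) → Walk F P x x
  step : ∀ {x y z} → T (P x) → T (adj F x y) → Walk F P y z → Walk F P x z

Connected : ∀ {n} → SimpleGraph n → Set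
Connected F = ∀ x y → Walk F (λ _ → true) x y

notV : ∀ {n} → Fin n → Fin n → Bool
notV v z = not ⌊ z FinP.≟ v ⌋

IsCutVertex : ∀ {n} → SimpleGraph n → Fin n → Set
IsCutVertex F v = Σ[ x ∈ _ ] Σ[ y ∈ _ ] x ≢ v × y ≢ v × ¬ Walk F (notV v) x y

-- comp : labelling of the vertices of F - v by Fin m whose classes are
-- exactly the m connected components of F - v (the value comp v is ignored):
-- each class is nonempty, each class is connected in F - v (indeed inside the
-- class), and there are no edges of F - v between different classes.
record VComponents {n} (F : SimpleGraph n) (v : Fin n) (m : ℕ) (comp : Fin n → Fin m) : Set where
  field
    nonempty  : ∀ i → Σ[ x ∈ Fin n ] x ≢ v × comp x ≡ i
    connected : ∀ x y → x ≢ v → y ≢ v → comp x ≡ comp y →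
                Walk F (λ z → notV v z ∧ ⌊ comp z FinP.≟ comp x ⌋) x y
    separated : ∀ x y → x ≢ v → y ≢ v → T (adj F x y) → comp x ≡ comp y

inComp : ∀ {n m} → Fin n → (Fin n → Fin m) → Fin m → Fin n → Bool
inComp v comp i x = ⌊ x FinP.≟ v ⌋ ∨ ⌊ comp x FinP.≟ i ⌋

vComponent : ∀ {n m} → SimpleGraph n → Fin n → (Fin n → Fin m) → Fin m → Gr
vComponent F v comp i = Induced F (inComp v comp i)

degIn : ∀ {n} → SimpleGraph n → (Fin n → Bool) → Fin n → ℕ
degIn {n} F P x = count (λ y → adj F x y ∧ P y) (allFin n)

sumFin : ∀ {m} → (Fin m → ℕ) → ℕ
sumFin {zero}  f = 0
sumFin {suc m} f = f Fin.zero + sumFin (λ i → f (Fin.suc i))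

record Hyp {n} (F : SimpleGraph n) (v : Fin n) (m : ℕ) (comp : Fin n → Fin m) (k : ℕ) : Set where
  field
    conn   : Connected F
    cut    : IsCutVertex F v
    comps  : VComponents F v m comp
    two≤k  : 2 ≤ k
    k<δ    : ∀ i x → T (inComp v comp i x) → k < degIn F (inComp v comp i) x

module Submission where

-- Each vertex (a,b) of F_I belongs to the inflation of the v-component containing the edge ab
-- (its tag), with the same neighbours there -- except for the clique X_v replacing v, which F_I
-- shares out among the components (CutVertex).
--   Upper bound: glued together, k-tuple total dominating sets of the G^i_I dominate F_I.
--   Lower bound: an optimal set S of F_I meets X_v in at least k vertices.  Restricting S to G^i_I
--   and completing its part s_i in X_v^i to k+1 vertices (Augment) dominates G^i_I, so
--   γ×k,t(G^i_I) ≤ |S_i| + (k+1 ∸ s_i); summing, with Σ s_i ≥ k, gives the bound (deficit-bound).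
--   Sharpness: an explicit graph on 11 vertices (Example), with upper bounds from Hamiltonian
--   cycles and lower bounds from disjoint degree-3 blocks (DegreeThree); its finite checks are
--   proved by evaluating decision procedures (Searchable, by-decision).

open import Defs hiding (sym)
open import Data.Nat using (ℕ; zero; suc; _+_; _*_; _∸_; _⊓_; _≤_; _<_; z≤n; s≤s; _≤?_; _<?_)
open import Data.Nat.Properties
open import Data.Nat.Solver using (module +-*-Solver)
open +-*-Solver using (solve; _:=_; _:+_; con)
open import Algebra.Properties.CommutativeSemigroup +-commutativeSemigroup using (interchange)
open import Data.Fin using (Fin; #_)
import Data.Fin as Fin
import Data.Fin.Properties as FinP
open import Data.Bool using (Bool; true; false; _∧_; _∨_; not; T; if_then_else_)
import Data.Bool as Bool
open import Data.Bool.Properties using (∨-comm; T-∧; T-∨; T-irrelevant; ∧-identityʳ; ∧-zeroʳ)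
open import Data.Unit using (tt)
open import Data.Empty using (⊥; ⊥-elim)
open import Data.Product using (Σ; Σ-syntax; _×_; _,_; proj₁; proj₂)
import Data.Product.Properties as ProdP
open import Data.Sum using (_⊎_; inj₁; inj₂)
open import Data.List using (List; []; _∷_; length; map; _++_; allFin; [_]; concatMap)
open import Data.List.Properties using (length-++; length-map; ++-assoc; map-++)
open import Data.Nat.ListAction using (sum)
open import Data.Nat.ListAction.Properties using (sum-++)
open import Data.List.Membership.Propositional using (_∈_)
open import Data.List.Membership.Propositional.Properties using (∈-++⁻; ∈-map⁻; ∈-map⁺)
import Data.List.Membership.DecPropositional as DecMembership
open import Data.List.Relation.Unary.Any using (here; there)
open import Data.List.Relation.Unary.All as All using (All; []; _∷_)
open import Data.List.Relation.Unary.All.Properties using (¬Any⇒All¬; All¬⇒¬Any)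
open import Data.List.Relation.Unary.AllPairs using ([]; _∷_)
open import Data.List.Relation.Unary.Unique.Propositional using (Unique)
import Data.List.Relation.Unary.Unique.Propositional.Properties as Unique
import Data.List.Relation.Unary.Unique.DecPropositional as UniqueDec
open import Function using (_∘_; Equivalence)
open import Relation.Binary.Definitions using (DecidableEquality)
open import Relation.Binary.PropositionalEquality
  using (_≡_; _≢_; refl; sym; trans; cong; cong₂; subst; module ≡-Reasoning)
open import Relation.Nullary using (¬_; ¬?; Dec; yes; no)
open import Relation.Nullary.Decidable using (⌊_⌋; T?; True; map′; _⊎-dec_; _×-dec_; _→-dec_; toWitness; fromWitness; toWitnessFalse; fromWitnessFalse)

open Equivalence using (to; from)

⌊⌋-cong : {A B : Set} → (A → B) → (B → A) → (a? : Dec A) (b? : Dec B) → ⌊ a? ⌋ ≡ ⌊ b? ⌋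
⌊⌋-cong f g (yes a)  (yes b)  = refl
⌊⌋-cong f g (yes a)  (no ¬b)  = ⊥-elim (¬b (f a))
⌊⌋-cong f g (no ¬a)  (yes b)  = ⊥-elim (¬a (g b))
⌊⌋-cong f g (no ¬a)  (no ¬b)  = refl

⌊T?⌋ : ∀ b → ⌊ T? b ⌋ ≡ b
⌊T?⌋ true  = refl
⌊T?⌋ false = refl

2≰1 : ¬ 2 ≤ 1
2≰1 (s≤s ())

ind : Bool → ℕ
ind true  = 1
ind false = 0

ind-mono : ∀ {b c} → (T b → T c) → ind b ≤ ind c
ind-mono {false}         _ = z≤n
ind-mono {true} {true}   _ = ≤-refl
ind-mono {true} {false}  h = ⊥-elim (h tt)

ind-T : ∀ {b} → T b → ind b ≡ 1
ind-T {true} _ = refl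

module Counting {A : Set} where

  count-∷ : (p : A → Bool) (x : A) (xs : List A) → count p (x ∷ xs) ≡ ind (p x) + count p xs
  count-∷ p x xs with p x
  ... | true  = refl
  ... | false = refl

  count-mono : {p q : A → Bool} → (∀ x → T (p x) → T (q x)) → ∀ xs → count p xs ≤ count q xs
  count-mono h [] = z≤n
  count-mono {p} {q} h (x ∷ xs) rewrite count-∷ p x xs | count-∷ q x xs =
    +-mono-≤ (ind-mono (h x)) (count-mono h xs)

  count-cong : {p q : A → Bool} → (∀ x → p x ≡ q x) → ∀ xs → count p xs ≡ count q xs
  count-cong h [] = refl
  count-cong {p} {q} h (x ∷ xs) rewrite count-∷ p x xs | count-∷ q x xs | h x =
    cong (ind (q x) +_) (count-cong h xs)

  count-none : {p : A → Bool} {xs : List A} → All (λ x → ¬ T (p x)) xs → count p xs ≡ 0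
  count-none [] = refl
  count-none {p} {x ∷ xs} (¬px ∷ h) with p x
  ... | true  = ⊥-elim (¬px tt)
  ... | false = count-none h

  count-true : ∀ (xs : List A) → count (λ _ → true) xs ≡ length xs
  count-true []       = refl
  count-true (x ∷ xs) = cong suc (count-true xs)

  count-++ : (p : A → Bool) → ∀ xs ys → count p (xs ++ ys) ≡ count p xs + count p ys
  count-++ p []       ys = refl
  count-++ p (x ∷ xs) ys rewrite count-∷ p x (xs ++ ys) | count-∷ p x xs | count-++ p xs ys =
    sym (+-assoc (ind (p x)) _ _)

  count-split : (p q : A → Bool) → ∀ xs →
                count p xs ≡ count (λ x → p x ∧ q x) xs + count (λ x → p x ∧ not (q x)) xs
  count-split p q [] = refl
  count-split p q (x ∷ xs)
    rewrite count-∷ p x xs | count-∷ (λ x → p x ∧ q x) x xs | count-∷ (λ x → p x ∧ not (q x)) x xs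
          | count-split p q xs with p x | q x
  ... | false | _     = refl
  ... | true  | true  = refl
  ... | true  | false = sym (+-suc _ _)

  count-∨ : (p q : A → Bool) → ∀ xs → count (λ x → p x ∨ q x) xs ≤ count p xs + count q xs
  count-∨ p q xs = begin
    count (λ x → p x ∨ q x) xs
      ≡⟨ count-split _ p xs ⟩
    count (λ x → (p x ∨ q x) ∧ p x) xs + count (λ x → (p x ∨ q x) ∧ not (p x)) xs
      ≤⟨ +-mono-≤ (count-mono (λ x → proj₂ ∘ to T-∧) xs) (count-mono (λ x → onlyQ (p x) (q x)) xs) ⟩
    count p xs + count q xs ∎
    where
    open ≤-Reasoning
    onlyQ : ∀ a b → T ((a ∨ b) ∧ not a) → T b
    onlyQ false true _ = tt

  count-∈ : (p : A → Bool) {x : A} {xs : List A} → x ∈ xs → T (p x) → 1 ≤ count p xs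
  count-∈ p {x} {.x ∷ xs} (here refl) px rewrite count-∷ p x xs | ind-T px = s≤s z≤n
  count-∈ p {_} {y ∷ xs}  (there x∈xs) px rewrite count-∷ p y xs =
    ≤-trans (count-∈ p x∈xs px) (m≤n+m _ _)

  count-witness : (p : A → Bool) (xs : List A) → 1 ≤ count p xs → Σ A λ x → x ∈ xs × T (p x)
  count-witness p (x ∷ xs) pos with p x in eq
  ... | true  = x , here refl , subst T (sym eq) tt
  ... | false = let (y , y∈xs , py) = count-witness p xs pos in y , there y∈xs , py

  count-≤1 : (p : A → Bool) → (∀ x y → T (p x) → T (p y) → x ≡ y) → ∀ xs → Unique xs → count p xs ≤ 1
  count-≤1 p h []       _ = z≤n
  count-≤1 p h (x ∷ xs) (x∉xs ∷ u) with p x in eq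
  ... | false = count-≤1 p h xs u
  ... | true  = ≤-reflexive (cong suc (count-none (All.map (λ x≢y py → x≢y (h _ _ px py)) x∉xs)))
    where
    px : T (p x)
    px = subst T (sym eq) tt

open Counting

count-map : ∀ {A B : Set} (p : B → Bool) (f : A → B) xs → count p (map f xs) ≡ count (p ∘ f) xs
count-map p f []       = refl
count-map p f (x ∷ xs) rewrite count-∷ p (f x) (map f xs) | count-∷ (p ∘ f) x xs =
  cong (ind (p (f x)) +_) (count-map p f xs)

module Removal {A : Set} (_≟_ : DecidableEquality A) where

  _∖_ : (A → Bool) → A → A → Bool
  (p ∖ u) y = p y ∧ not ⌊ y ≟ u ⌋

  count-remove : (p : A → Bool) (u : A) → ∀ xs → Unique xs → count p xs ≤ count (p ∖ u) xs + 1
  count-remove p u xs uniq = begin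
    count p xs                                                   ≡⟨ count-split p (λ y → ⌊ y ≟ u ⌋) xs ⟩
    count (λ y → p y ∧ ⌊ y ≟ u ⌋) xs + count (p ∖ u) xs         ≤⟨ +-monoˡ-≤ _ at-most-u ⟩
    1 + count (p ∖ u) xs                                         ≡⟨ +-comm 1 _ ⟩
    count (p ∖ u) xs + 1                                         ∎
    where
    open ≤-Reasoning
    at-most-u : count (λ y → p y ∧ ⌊ y ≟ u ⌋) xs ≤ 1
    at-most-u = count-≤1 _ (λ x y px py → trans (is-u x px) (sym (is-u y py))) xs uniq
      where
      is-u : ∀ y → T (p y ∧ ⌊ y ≟ u ⌋) → y ≡ u
      is-u y t = toWitness (proj₂ (to (T-∧ {p y}) t))

  count-remove-∈ : (p : A → Bool) (u : A) → ∀ xs → u ∈ xs → T (p u) → count (p ∖ u) xs + 1 ≤ count p xs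
  count-remove-∈ p u xs u∈xs pu = begin
    count (p ∖ u) xs + 1                                         ≡⟨ +-comm _ 1 ⟩
    1 + count (p ∖ u) xs                                         ≤⟨ +-monoˡ-≤ _ has-u ⟩
    count (λ y → p y ∧ ⌊ y ≟ u ⌋) xs + count (p ∖ u) xs         ≡⟨ count-split p (λ y → ⌊ y ≟ u ⌋) xs ⟨
    count p xs                                                   ∎
    where
    open ≤-Reasoning
    has-u : 1 ≤ count (λ y → p y ∧ ⌊ y ≟ u ⌋) xs
    has-u = count-∈ _ u∈xs (from T-∧ (pu , fromWitness refl))

sumFin-cong : ∀ {m} {f g : Fin m → ℕ} → (∀ i → f i ≡ g i) → sumFin f ≡ sumFin g
sumFin-cong {zero}  h = refl
sumFin-cong {suc m} h = cong₂ _+_ (h Fin.zero) (sumFin-cong (h ∘ Fin.suc))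

sumFin-mono : ∀ {m} {f g : Fin m → ℕ} → (∀ i → f i ≤ g i) → sumFin f ≤ sumFin g
sumFin-mono {zero}  h = z≤n
sumFin-mono {suc m} h = +-mono-≤ (h Fin.zero) (sumFin-mono (h ∘ Fin.suc))

sumFin-+ : ∀ {m} (f g : Fin m → ℕ) → sumFin (λ i → f i + g i) ≡ sumFin f + sumFin g
sumFin-+ {zero}  f g = refl
sumFin-+ {suc m} f g rewrite sumFin-+ (f ∘ Fin.suc) (g ∘ Fin.suc) =
  interchange (f Fin.zero) (g Fin.zero) (sumFin (f ∘ Fin.suc)) (sumFin (g ∘ Fin.suc))

sumFin-const : ∀ m c → sumFin {m} (λ _ → c) ≡ m * c
sumFin-const zero    c = refl
sumFin-const (suc m) c = cong (c +_) (sumFin-const m c)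

⊓-subadditive : ∀ a b k → (a + b) ⊓ k ≤ a ⊓ k + b ⊓ k
⊓-subadditive a b k with a ≤? k | b ≤? k
... | yes a≤k | yes b≤k rewrite m≤n⇒m⊓n≡m a≤k | m≤n⇒m⊓n≡m b≤k = m⊓n≤m (a + b) k
... | yes a≤k | no  b≰k rewrite m≥n⇒m⊓n≡n (≰⇒≥ b≰k) = ≤-trans (m⊓n≤n (a + b) k) (m≤n+m k (a ⊓ k))
... | no  a≰k | _       rewrite m≥n⇒m⊓n≡n (≰⇒≥ a≰k) = ≤-trans (m⊓n≤n (a + b) k) (m≤m+n k (b ⊓ k))

sumFin-⊓ : ∀ {m} (f : Fin m → ℕ) k → sumFin f ⊓ k ≤ sumFin (λ i → f i ⊓ k)
sumFin-⊓ {zero}  f k = z≤n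
sumFin-⊓ {suc m} f k = ≤-trans (⊓-subadditive (f Fin.zero) (sumFin (f ∘ Fin.suc)) k)
                               (+-monoʳ-≤ (f Fin.zero ⊓ k) (sumFin-⊓ (f ∘ Fin.suc) k))

-- The arithmetic core of the lower bound: m parts, each short of k+1 by (k+1 ∸ f i), with at
-- least k in total, are short by at most m(k+1) - k altogether.
deficit-bound : ∀ {m} (f : Fin m → ℕ) k → k ≤ sumFin f → sumFin (λ i → suc k ∸ f i) + k ≤ m * suc k
deficit-bound {m} f k k≤Σf = begin
  deficit + k                   ≡⟨ cong (deficit +_) (m≥n⇒m⊓n≡n k≤Σf) ⟨
  deficit + sumFin f ⊓ k        ≤⟨ +-monoʳ-≤ deficit (sumFin-⊓ f k) ⟩
  deficit + capped k            ≤⟨ +-monoʳ-≤ deficit (sumFin-mono (λ i → ⊓-monoʳ-≤ (f i) (n≤1+n k))) ⟩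
  deficit + capped (suc k)      ≡⟨ +-comm deficit (capped (suc k)) ⟩
  capped (suc k) + deficit      ≡⟨ sumFin-+ (λ i → f i ⊓ suc k) (λ i → suc k ∸ f i) ⟨
  sumFin (λ i → f i ⊓ suc k + (suc k ∸ f i))  ≡⟨ sumFin-cong (λ i → m⊓n+n∸m≡n (f i) (suc k)) ⟩
  sumFin {m} (λ _ → suc k)      ≡⟨ sumFin-const m (suc k) ⟩
  m * suc k                     ∎
  where
  open ≤-Reasoning
  deficit : ℕ
  deficit = sumFin (λ i → suc k ∸ f i)
  capped : ℕ → ℕ
  capped c = sumFin (λ i → f i ⊓ c)

sumFin-zero : ∀ m → sumFin {m} (λ _ → 0) ≡ 0
sumFin-zero m = trans (sumFin-const m 0) (*-zeroʳ m)

sumFin-ind-≟ : ∀ {m} (j : Fin m) (b : Bool) → sumFin (λ i → ind (⌊ j FinP.≟ i ⌋ ∧ b)) ≡ ind b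
sumFin-ind-≟ {suc m} Fin.zero    b = trans (cong (ind b +_) (sumFin-zero m)) (+-identityʳ (ind b))
sumFin-ind-≟ {suc m} (Fin.suc j) b =
  trans (sumFin-cong (λ i → cong (λ c → ind (c ∧ b)) (⌊⌋-cong FinP.suc-injective (cong Fin.suc) (Fin.suc j FinP.≟ Fin.suc i) (j FinP.≟ i))))
        (sumFin-ind-≟ j b)

partition : ∀ {A : Set} {m} (h : A → Fin m) (q : A → Bool) (xs : List A) →
            sumFin (λ i → count (λ x → ⌊ h x FinP.≟ i ⌋ ∧ q x) xs) ≡ count q xs
partition {m = m} h q [] = sumFin-zero m
partition h q (x ∷ xs) = begin
  sumFin (λ i → count (class i) (x ∷ xs))                         ≡⟨ sumFin-cong (λ i → count-∷ (class i) x xs) ⟩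
  sumFin (λ i → ind (class i x) + count (class i) xs)             ≡⟨ sumFin-+ (λ i → ind (class i x)) (λ i → count (class i) xs) ⟩
  sumFin (λ i → ind (class i x)) + sumFin (λ i → count (class i) xs)
                                                                   ≡⟨ cong₂ _+_ (sumFin-ind-≟ (h x) (q x)) (partition h q xs) ⟩
  ind (q x) + count q xs                                           ≡⟨ count-∷ q x xs ⟨
  count q (x ∷ xs)                                                 ∎
  where
  open ≡-Reasoning
  class : _ → _ → Bool
  class i y = ⌊ h y FinP.≟ i ⌋ ∧ q y

module FilterMap {A B : Set} {P : A → Set} (P? : ∀ x → Dec (P x)) (f : (x : A) → P x → B) where

  keep : (x : A) → Dec (P x) → List B → List B
  keep x (yes px) ys = f x px ∷ ys
  keep x (no _)   ys = ys

  filterMap : List A → List B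
  filterMap []       = []
  filterMap (x ∷ xs) = keep x (P? x) (filterMap xs)

  count-filterMap : (q : B → Bool) (q' : A → Bool) → (∀ x px → q (f x px) ≡ q' x) →
                    ∀ xs → count q (filterMap xs) ≡ count (λ x → ⌊ P? x ⌋ ∧ q' x) xs
  count-filterMap q q' hq [] = refl
  count-filterMap q q' hq (x ∷ xs) =
    trans (by-cases (P? x)) (sym (count-∷ (λ x → ⌊ P? x ⌋ ∧ q' x) x xs))
    where
    by-cases : (d : Dec (P x)) → count q (keep x d (filterMap xs)) ≡ ind (⌊ d ⌋ ∧ q' x) + count (λ x → ⌊ P? x ⌋ ∧ q' x) xs
    by-cases (yes px) = trans (count-∷ q (f x px) _) (cong₂ _+_ (cong ind (hq x px)) (count-filterMap q q' hq xs))
    by-cases (no _)   = count-filterMap q q' hq xs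

  ∈-filterMap : ∀ {y} xs → y ∈ filterMap xs → Σ A λ x → x ∈ xs × Σ (P x) λ px → y ≡ f x px
  ∈-filterMap (x ∷ xs) = by-cases (P? x)
    where
    by-cases : ∀ {y} (d : Dec (P x)) → y ∈ keep x d (filterMap xs) → Σ A λ x' → x' ∈ x ∷ xs × Σ (P x') λ px → y ≡ f x' px
    by-cases (yes px) (here y≡fx) = x , here refl , px , y≡fx
    by-cases (yes px) (there y∈)  = let (x' , x'∈ , px' , eq) = ∈-filterMap xs y∈ in x' , there x'∈ , px' , eq
    by-cases (no _)   y∈          = let (x' , x'∈ , px' , eq) = ∈-filterMap xs y∈ in x' , there x'∈ , px' , eq

  unique-filterMap : (∀ x y px py → f x px ≡ f y py → x ≡ y) → ∀ xs → Unique xs → Unique (filterMap xs)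
  unique-filterMap inj []       _            = []
  unique-filterMap inj (x ∷ xs) (x∉xs ∷ uniq) = by-cases (P? x)
    where
    by-cases : (d : Dec (P x)) → Unique (keep x d (filterMap xs))
    by-cases (yes px) = All.tabulate fresh ∷ unique-filterMap inj xs uniq
      where
      fresh : ∀ {y} → y ∈ filterMap xs → f x px ≢ y
      fresh y∈ fx≡y with ∈-filterMap xs y∈
      ... | x' , x'∈ , px' , refl = All.lookup x∉xs x'∈ (inj x x' px px' fx≡y)
    by-cases (no _) = unique-filterMap inj xs uniq

open FilterMap using (filterMap; count-filterMap; ∈-filterMap; unique-filterMap)

concatFin : ∀ {A : Set} {m} → (Fin m → List A) → List A
concatFin {m = zero}  L = []
concatFin {m = suc m} L = L Fin.zero ++ concatFin (L ∘ Fin.suc)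

module _ {A : Set} where

  length-concatFin : ∀ {m} (L : Fin m → List A) → length (concatFin L) ≡ sumFin (length ∘ L)
  length-concatFin {zero}  L = refl
  length-concatFin {suc m} L = trans (length-++ (L Fin.zero)) (cong (length (L Fin.zero) +_) (length-concatFin (L ∘ Fin.suc)))

  count-concatFin : ∀ {m} (p : A → Bool) (L : Fin m → List A) i → count p (L i) ≤ count p (concatFin L)
  count-concatFin {suc m} p L Fin.zero    rewrite count-++ p (L Fin.zero) (concatFin (L ∘ Fin.suc)) = m≤m+n _ _
  count-concatFin {suc m} p L (Fin.suc i) rewrite count-++ p (L Fin.zero) (concatFin (L ∘ Fin.suc)) =
    ≤-trans (count-concatFin p (L ∘ Fin.suc) i) (m≤n+m _ _)

  ∈-concatFin : ∀ {m} (L : Fin m → List A) {x} → x ∈ concatFin L → Σ (Fin m) λ i → x ∈ L i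
  ∈-concatFin {suc m} L x∈ with ∈-++⁻ (L Fin.zero) x∈
  ... | inj₁ x∈L₀ = Fin.zero , x∈L₀
  ... | inj₂ x∈   = let (i , x∈Li) = ∈-concatFin (L ∘ Fin.suc) x∈ in Fin.suc i , x∈Li

  unique-concatFin : ∀ {m} (L : Fin m → List A) → (∀ i → Unique (L i)) →
                     (∀ i j {x} → x ∈ L i → x ∈ L j → i ≡ j) → Unique (concatFin L)
  unique-concatFin {zero}  L uniq disj = []
  unique-concatFin {suc m} L uniq disj =
    Unique.++⁺ (uniq Fin.zero)
               (unique-concatFin (L ∘ Fin.suc) (uniq ∘ Fin.suc) (λ i j x∈ x∈' → FinP.suc-injective (disj _ _ x∈ x∈')))
               (λ (x∈L₀ , x∈) → let (j , x∈Lj) = ∈-concatFin (L ∘ Fin.suc) x∈ in zero≢suc (disj _ _ x∈L₀ x∈Lj))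
    where
    zero≢suc : ∀ {j : Fin m} → Fin.zero ≢ Fin.suc j
    zero≢suc ()

module Augment {A : Set} (_≟_ : DecidableEquality A) (p : A → Bool) (t : ℕ) where
  open DecMembership _≟_ using (_∈?_)
  open Removal _≟_

  Enlargement : List A → Set
  Enlargement S = Σ (List A) λ E → length E ≤ t ∸ count p S × Unique (E ++ S) × t ≤ count p (E ++ S)

  _∈ᵇ_ : A → List A → Bool
  y ∈ᵇ []      = false
  y ∈ᵇ (x ∷ L) = ⌊ y ≟ x ⌋ ∨ y ∈ᵇ L

  ∈ᵇ-sound : ∀ {y} L → T (y ∈ᵇ L) → y ∈ L
  ∈ᵇ-sound {y} (x ∷ L) t with y ≟ x
  ... | yes y≡x = here y≡x
  ... | no  _   = there (∈ᵇ-sound L t)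

  outside : List A → A → Bool
  outside L y = p y ∧ not (y ∈ᵇ L)

  outside-∷ : ∀ x L y → outside (x ∷ L) y ≡ (outside L ∖ x) y
  outside-∷ x L y with p y | ⌊ y ≟ x ⌋ | y ∈ᵇ L
  ... | false | _     | _     = refl
  ... | true  | true  | _     = sym (∧-zeroʳ _)
  ... | true  | false | true  = refl
  ... | true  | false | false = refl

  outside-head : ∀ {x L} → All (x ≢_) L → T (p x) → T (outside L x)
  outside-head {x} {L} x∉L px = from T-∧ (px , not-member)
    where
    not-member : T (not (x ∈ᵇ L))
    not-member with x ∈ᵇ L in eq
    ... | true  = ⊥-elim (All¬⇒¬Any x∉L (∈ᵇ-sound L (subst T (sym eq) tt)))
    ... | false = tt

  enlarge : ∀ L S → Unique L → All (T ∘ p) L → Unique S → t ≤ count (outside L) S + length L → Enlargement S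
  enlarge [] S _ _ uS inv = [] , z≤n , uS , subst (t ≤_) enough inv
    where
    enough : count (outside []) S + 0 ≡ count p S
    enough = trans (+-identityʳ _) (count-cong (λ y → ∧-identityʳ (p y)) S)
  enlarge (x ∷ L) S (x∉L ∷ uL) (px ∷ pL) uS inv with x ∈? S
  ... | yes x∈S = enlarge L S uL pL uS (≤-trans inv (begin
          count (outside (x ∷ L)) S + suc (length L)   ≡⟨ cong (_+ suc (length L)) (count-cong (outside-∷ x L) S) ⟩
          count (outside L ∖ x) S + suc (length L)     ≡⟨ +-suc _ (length L) ⟩
          suc (count (outside L ∖ x) S + length L)     ≡⟨ cong (_+ length L) (+-comm 1 _) ⟩
          count (outside L ∖ x) S + 1 + length L       ≤⟨ +-monoˡ-≤ (length L) (count-remove-∈ (outside L) x S x∈S (outside-head x∉L px)) ⟩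
          count (outside L) S + length L               ∎))
    where open ≤-Reasoning
  ... | no x∉S with t ≤? count p S
  ...   | yes done = [] , z≤n , uS , done
  ...   | no short with enlarge L (x ∷ S) uL pL (¬Any⇒All¬ S x∉S ∷ uS) (≤-trans inv (begin
            count (outside (x ∷ L)) S + suc (length L)   ≡⟨ +-suc _ (length L) ⟩
            suc (count (outside (x ∷ L)) S) + length L   ≤⟨ +-monoˡ-≤ (length L) (s≤s (count-mono (λ y → outside-drop y) S)) ⟩
            suc (count (outside L) S) + length L         ≡⟨ cong (λ c → c + count (outside L) S + length L) (ind-T (outside-head x∉L px)) ⟨
            ind (outside L x) + count (outside L) S + length L ≡⟨ cong (_+ length L) (count-∷ (outside L) x S) ⟨
            count (outside L) (x ∷ S) + length L         ∎))
    where
    open ≤-Reasoning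
    outside-drop : ∀ y → T (outside (x ∷ L) y) → T (outside L y)
    outside-drop y o = proj₁ (to T-∧ (subst T (outside-∷ x L y) o))
  ...     | E , |E|≤ , uE , tE =
    E ++ [ x ] , length-bound , subst Unique (sym assoc) uE , subst (λ R → t ≤ count p R) (sym assoc) tE
    where
    assoc : (E ++ [ x ]) ++ S ≡ E ++ x ∷ S
    assoc = ++-assoc E [ x ] S
    length-bound : length (E ++ [ x ]) ≤ t ∸ count p S
    length-bound = begin
      length (E ++ [ x ])                  ≡⟨ length-++ E ⟩
      length E + 1                         ≤⟨ +-monoˡ-≤ 1 |E|≤ ⟩
      t ∸ count p (x ∷ S) + 1              ≡⟨ cong (λ c → t ∸ c + 1) (count-∷ p x S) ⟩
      t ∸ (ind (p x) + count p S) + 1      ≡⟨ cong (λ c → t ∸ (c + count p S) + 1) (ind-T px) ⟩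
      t ∸ suc (count p S) + 1              ≡⟨ +-comm _ 1 ⟩
      suc (t ∸ suc (count p S))            ≡⟨ +-∸-assoc 1 (≰⇒> short) ⟨
      t ∸ count p S                        ∎
      where open ≤-Reasoning

  augment : ∀ L S → Unique L → All (T ∘ p) L → t ≤ length L → Unique S → Enlargement S
  augment L S uL pL t≤|L| uS = enlarge L S uL pL uS (≤-trans t≤|L| (m≤n+m _ _))

module Inflated (G : Gr) where

  vertex-≡ : ∀ {a b c d} {e : T (E G a b)} {e' : T (E G c d)} → a ≡ c → b ≡ d →
             _≡_ {A = IV G} ((a , b) , e) ((c , d) , e')
  vertex-≡ {a} {b} {e = e} {e'} refl refl = cong ((a , b) ,_) (T-irrelevant e e')

  inflated-adj : ∀ a b c d {e : T (E G a b)} {e' : T (E G c d)} →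
                 T (IE G ((a , b) , e) ((c , d) , e')) → (a ≡ c × b ≢ d) ⊎ (a ≡ d × b ≡ c)
  inflated-adj a b c d t with to (T-∨ {⌊ dec G a c ⌋ ∧ not ⌊ dec G b d ⌋}) t
  ... | inj₁ same-clique = let (a≡c , b≢d) = to (T-∧ {⌊ dec G a c ⌋}) same-clique in
                           inj₁ (toWitness a≡c , toWitnessFalse b≢d)
  ... | inj₂ same-edge   = let (a≡d , b≡c) = to (T-∧ {⌊ dec G a d ⌋}) same-edge in
                           inj₂ (toWitness a≡d , toWitness b≡c)

  clique-adj : ∀ a b c d {e : T (E G a b)} {e' : T (E G c d)} →
               a ≡ c → b ≢ d → T (IE G ((a , b) , e) ((c , d) , e'))
  clique-adj a b c d a≡c b≢d =
    from (T-∨ {⌊ dec G a c ⌋ ∧ not ⌊ dec G b d ⌋}) (inj₁ (from (T-∧ {⌊ dec G a c ⌋}) (fromWitness a≡c , fromWitnessFalse b≢d)))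

module InducedInflation {n} (F : SimpleGraph n) (P : Fin n → Bool) where

  ι : IV (Induced F P) → IV (AsGr F)
  ι (((a , _) , (b , _)) , e) = (a , b) , e

  restrict : (x : IV (AsGr F)) → T (P (proj₁ (proj₁ x))) → T (P (proj₂ (proj₁ x))) → IV (Induced F P)
  restrict ((a , b) , e) pa pb = ((a , pa) , (b , pb)) , e

  ι-injective : ∀ x y → ι x ≡ ι y → x ≡ y
  ι-injective (((a , pa) , (b , pb)) , e) (((.a , pa') , (.b , pb')) , .e) refl
    rewrite T-irrelevant pa pa' | T-irrelevant pb pb' = refl

  ι-adj : ∀ x y → IE (Induced F P) x y ≡ IE (AsGr F) (ι x) (ι y)
  ι-adj (((a , pa) , (b , pb)) , _) (((c , pc) , (d , pd)) , _) =
    cong₂ _∨_ (cong₂ _∧_ (same (a , pa) (c , pc)) (cong not (same (b , pb) (d , pd))))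
              (cong₂ _∧_ (same (a , pa) (d , pd)) (same (b , pb) (c , pc)))
    where
    same : ∀ x y → ⌊ dec (Induced F P) x y ⌋ ≡ ⌊ proj₁ x FinP.≟ proj₁ y ⌋
    same (x , px) (y , py) = ⌊⌋-cong (cong proj₁) (λ { refl → cong (x ,_) (T-irrelevant px py) })
                                     (dec (Induced F P) (x , px) (y , py)) (x FinP.≟ y)

module CutVertex {n} (F : SimpleGraph n) (v : Fin n) {m} (comp : Fin n → Fin m)
                 (separated : ∀ x y → x ≢ v → y ≢ v → T (adj F x y) → comp x ≡ comp y) where

  VF : Set
  VF = IV (AsGr F)

  EF : VF → VF → Bool
  EF = IE (AsGr F)

  _≟F_ : DecidableEquality VF
  _≟F_ = dec (Inflate (AsGr F))

  G : Fin m → Gr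
  G = vComponent F v comp

  VG : Fin m → Set
  VG i = IV (G i)

  EG : ∀ i → VG i → VG i → Bool
  EG i = IE (G i)

  _≟G_ : ∀ {i} → DecidableEquality (VG i)
  _≟G_ {i} = dec (Inflate (G i))

  module Embedding (i : Fin m) = InducedInflation F (inComp v comp i)
  open Embedding using (ι; ι-injective; ι-adj)

  open Inflated (AsGr F) using (vertex-≡; inflated-adj; clique-adj)

  in-component : ∀ {i a} → (a ≡ v ⊎ comp a ≡ i) → T (inComp v comp i a)
  in-component {i} {a} (inj₁ a≡v)  = from (T-∨ {⌊ a FinP.≟ v ⌋}) (inj₁ (fromWitness a≡v))
  in-component {i} {a} (inj₂ ca≡i) = from (T-∨ {⌊ a FinP.≟ v ⌋}) (inj₂ (fromWitness ca≡i))

  component-of : ∀ {i a} → T (inComp v comp i a) → a ≢ v → comp a ≡ i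
  component-of {i} {a} t a≢v with to (T-∨ {⌊ a FinP.≟ v ⌋}) t
  ... | inj₁ a≡v  = ⊥-elim (a≢v (toWitness a≡v))
  ... | inj₂ ca≡i = toWitness ca≡i

  no-loop : ∀ {a b} → T (adj F a b) → a ≢ b
  no-loop {a} e refl = subst T (irrefl F a) e

  -- The component an inflated vertex (a,b) belongs to: that of the edge ab.
  tag : VF → Fin m
  tag ((a , b) , _) = if ⌊ a FinP.≟ v ⌋ then comp b else comp a

  tag-at-v : ∀ {a} b e → a ≡ v → tag ((a , b) , e) ≡ comp b
  tag-at-v {a} _ _ a≡v with a FinP.≟ v
  ... | yes _   = refl
  ... | no  a≢v = ⊥-elim (a≢v a≡v)

  tag-off-v : ∀ {a} b e → a ≢ v → tag ((a , b) , e) ≡ comp a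
  tag-off-v {a} _ _ a≢v with a FinP.≟ v
  ... | yes a≡v = ⊥-elim (a≢v a≡v)
  ... | no  _   = refl

  ends-in-component : ∀ {i} (x : VF) → tag x ≡ i →
                      T (inComp v comp i (proj₁ (proj₁ x))) × T (inComp v comp i (proj₂ (proj₁ x)))
  ends-in-component {i} ((a , b) , e) tag≡i = by-cases (a FinP.≟ v) (b FinP.≟ v)
    where
    by-cases : Dec (a ≡ v) → Dec (b ≡ v) → T (inComp v comp i a) × T (inComp v comp i b)
    by-cases (yes a≡v) _         = in-component (inj₁ a≡v) , in-component (inj₂ (trans (sym (tag-at-v b e a≡v)) tag≡i))
    by-cases (no a≢v)  (yes b≡v) = in-component (inj₂ (trans (sym (tag-off-v b e a≢v)) tag≡i)) , in-component (inj₁ b≡v)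
    by-cases (no a≢v)  (no b≢v)  = in-component (inj₂ ca≡i) , in-component (inj₂ (trans (sym (separated a b a≢v b≢v e)) ca≡i))
      where
      ca≡i : comp a ≡ i
      ca≡i = trans (sym (tag-off-v b e a≢v)) tag≡i

  lift : ∀ i (x : VF) → tag x ≡ i → VG i
  lift i x tag≡i = let (pa , pb) = ends-in-component x tag≡i in Embedding.restrict i x pa pb

  tag-ι : ∀ {i} (y : VG i) → tag (ι i y) ≡ i
  tag-ι {i} (((a , pa) , (b , pb)) , e) = by-cases (a FinP.≟ v)
    where
    by-cases : Dec (a ≡ v) → tag ((a , b) , e) ≡ i
    by-cases (yes a≡v) = trans (tag-at-v b e a≡v) (component-of pb (λ b≡v → no-loop e (trans a≡v (sym b≡v))))
    by-cases (no a≢v)  = trans (tag-off-v b e a≢v) (component-of pa a≢v)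

  tag-adj : ∀ {a b e} (y : VF) → a ≢ v → T (EF ((a , b) , e) y) → tag y ≡ tag ((a , b) , e)
  tag-adj {a} {b} {e} ((c , d) , e') a≢v x~y with inflated-adj a b c d {e} {e'} x~y
  ... | inj₁ (refl , _) = trans (tag-off-v d e' a≢v) (sym (tag-off-v b e a≢v))
  ... | inj₂ (refl , refl) = by-cases (c FinP.≟ v)
    where
    by-cases : Dec (c ≡ v) → tag ((c , a) , e') ≡ tag ((a , c) , e)
    by-cases (yes c≡v) = trans (tag-at-v a e' c≡v) (sym (tag-off-v c e a≢v))
    by-cases (no c≢v)  = trans (tag-off-v a e' c≢v) (trans (sym (separated a c a≢v c≢v e)) (sym (tag-off-v c e a≢v)))

  atV : VF → Bool
  atV ((a , _) , _) = ⌊ a FinP.≟ v ⌋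

  partner : VF → VF
  partner ((a , b) , e) = (b , a) , subst T (SimpleGraph.sym F a b) e

  open Removal _≟F_ using (_∖_; count-remove-∈)

  clique-v-nbrs : ∀ u → T (atV u) → ∀ y → T (EF u y) → T ((atV ∖ u) y ∨ ⌊ y ≟F partner u ⌋)
  clique-v-nbrs ((a , b) , e) u∈Xv ((c , d) , e') u~y with inflated-adj a b c d {e} {e'} u~y
  ... | inj₁ (refl , b≢d) =
    from (T-∨ {(atV ∖ ((a , b) , e)) ((c , d) , e')})
         (inj₁ (from (T-∧ {atV ((c , d) , e')}) (u∈Xv , fromWitnessFalse λ y≡u → b≢d (sym (cong (proj₂ ∘ proj₁) y≡u)))))
  ... | inj₂ (refl , refl) =
    from (T-∨ {(atV ∖ ((a , b) , e)) ((c , d) , e')})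
         (inj₂ (fromWitness (vertex-≡ refl refl)))

  clique-v-adj : ∀ {i} (x y : VG i) → T (atV (ι i x)) → T (atV (ι i y)) → y ≢ x → T (EG i x y)
  clique-v-adj {i} x@(((a , _) , (b , _)) , e) y@(((c , _) , (d , _)) , e') x∈Xv y∈Xv y≢x =
    subst T (sym (ι-adj i x y))
      (clique-adj a b c d {e} {e'} (trans (toWitness x∈Xv) (sym (toWitness y∈Xv)))
                  (λ b≡d → y≢x (ι-injective i y x (vertex-≡ (trans (toWitness y∈Xv) (sym (toWitness x∈Xv))) (sym b≡d)))))

  -- Gluing k-tuple total dominating sets S i of the (G i)_I gives one of F_I: a vertex of F_I in
  -- component i has in F_I all the neighbours it has in (G i)_I.
  module Gluing {k} (S : ∀ i → List (VG i)) (tds : ∀ i → IsKTupleTDS (Inflate (G i)) k (S i)) where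

    pieces : Fin m → List VF
    pieces i = map (ι i) (S i)

    glued : List VF
    glued = concatFin pieces

    length-glued : length glued ≡ sumFin (length ∘ S)
    length-glued = trans (length-concatFin pieces) (sumFin-cong (λ i → length-map (ι i) (S i)))

    tag-pieces : ∀ i {x} → x ∈ pieces i → tag x ≡ i
    tag-pieces i x∈ with ∈-map⁻ (ι i) x∈
    ... | y , _ , refl = tag-ι y

    glued-TDS : IsKTupleTDS (Inflate (AsGr F)) k glued
    glued-TDS = unique-glued , dominated
      where
      unique-glued : Unique glued
      unique-glued = unique-concatFin pieces (λ i → Unique.map⁺ (ι-injective i _ _) (proj₁ (tds i)))
                                      (λ i j x∈i x∈j → trans (sym (tag-pieces i x∈i)) (tag-pieces j x∈j))
      dominated : ∀ x → k ≤ count (EF x) glued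
      dominated x = begin
        k                                        ≤⟨ proj₂ (tds i) x' ⟩
        count (EG i x') (S i)                    ≡⟨ count-cong (ι-adj i x') (S i) ⟩
        count (EF x ∘ ι i) (S i)                 ≡⟨ count-map (EF x) (ι i) (S i) ⟨
        count (EF x) (pieces i)                  ≤⟨ count-concatFin (EF x) pieces i ⟩
        count (EF x) glued                       ∎
        where
        open ≤-Reasoning
        i : Fin m
        i = tag x
        x' : VG i
        x' = lift i x refl

  upper-bound : ∀ {k} (c : Fin m → ℕ) (cF : ℕ) → (∀ i → IsGammaKT (Inflate (G i)) k (c i)) →
                IsGammaKT (Inflate (AsGr F)) k cF → cF ≤ sumFin c
  upper-bound c cF γG γF = begin
    cF                       ≤⟨ proj₂ γF glued glued-TDS ⟩
    length glued             ≡⟨ length-glued ⟩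
    sumFin (length ∘ S)      ≡⟨ sumFin-cong (λ i → proj₂ (proj₂ (proj₁ (γG i)))) ⟩
    sumFin c                 ∎
    where
    open ≤-Reasoning
    S : ∀ i → List (VG i)
    S i = proj₁ (proj₁ (γG i))
    open Gluing S (λ i → proj₁ (proj₂ (proj₁ (γG i))))

  nbr-of-v? : ∀ i y → Dec (T (adj F v y ∧ inComp v comp i y))
  nbr-of-v? i y = T? (adj F v y ∧ inComp v comp i y)

  vertex-at-v : ∀ i y → T (adj F v y ∧ inComp v comp i y) → VG i
  vertex-at-v i y t = let (e , py) = to (T-∧ {adj F v y}) t in ((v , in-component (inj₁ refl)) , (y , py)) , e

  clique-v : ∀ i → List (VG i)
  clique-v i = filterMap (nbr-of-v? i) (vertex-at-v i) (allFin n)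

  length-clique-v : ∀ i → length (clique-v i) ≡ degIn F (inComp v comp i) v
  length-clique-v i = begin
    length (clique-v i)                     ≡⟨ count-true (clique-v i) ⟨
    count (λ _ → true) (clique-v i)         ≡⟨ count-filterMap (nbr-of-v? i) (vertex-at-v i) _ (λ _ → true) (λ _ _ → refl) (allFin n) ⟩
    count (λ y → ⌊ nbr-of-v? i y ⌋ ∧ true) (allFin n)  ≡⟨ count-cong (λ y → trans (∧-identityʳ _) (⌊T?⌋ _)) (allFin n) ⟩
    degIn F (inComp v comp i) v             ∎
    where open ≡-Reasoning

  unique-clique-v : ∀ i → Unique (clique-v i)
  unique-clique-v i = unique-filterMap (nbr-of-v? i) (vertex-at-v i)
                        (λ y y' _ _ eq → cong (proj₁ ∘ proj₂ ∘ proj₁) eq) (allFin n) (Unique.allFin⁺ n)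

  all-at-v : ∀ i → All (λ x → T (atV (ι i x))) (clique-v i)
  all-at-v i = All.tabulate λ x∈ → let (_ , _ , _ , x≡) = ∈-filterMap (nbr-of-v? i) (vertex-at-v i) (allFin n) x∈ in
                                  subst (λ x → T (atV (ι i x))) (sym x≡) (fromWitness refl)

  restrict-to : ∀ i → List VF → List (VG i)
  restrict-to i = filterMap (λ x → tag x FinP.≟ i) (lift i)

  count-restrict : ∀ i (q : VG i → Bool) (q' : VF → Bool) → (∀ x p → q (lift i x p) ≡ q' x) →
                   ∀ S → count q (restrict-to i S) ≡ count (λ x → ⌊ tag x FinP.≟ i ⌋ ∧ q' x) S
  count-restrict i = count-filterMap (λ x → tag x FinP.≟ i) (lift i)

  module LowerBound {k} (two≤k : 2 ≤ k) (v-deg : ∀ i → k < degIn F (inComp v comp i) v)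
                    (S : List VF) (tds : IsKTupleTDS (Inflate (AsGr F)) k S) where

    -- A vertex u of X_v has at most one neighbour outside X_v (its partner).
    nbrs-at-v : ∀ u → T (atV u) → k ≤ count (atV ∖ u) S + 1
    nbrs-at-v u u∈Xv = begin
      k                                                          ≤⟨ proj₂ tds u ⟩
      count (EF u) S                                             ≤⟨ count-mono (clique-v-nbrs u u∈Xv) S ⟩
      count (λ y → (atV ∖ u) y ∨ is-partner y) S                 ≤⟨ count-∨ (atV ∖ u) is-partner S ⟩
      count (atV ∖ u) S + count is-partner S                     ≤⟨ +-monoʳ-≤ _ one-partner ⟩
      count (atV ∖ u) S + 1                                      ∎
      where
      open ≤-Reasoning
      is-partner : VF → Bool
      is-partner y = ⌊ y ≟F partner u ⌋
      one-partner : count is-partner S ≤ 1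
      one-partner = count-≤1 is-partner (λ x y x≡ y≡ → trans (toWitness x≡) (sym (toWitness y≡))) S (proj₁ tds)

    -- Hence S meets X_v in at least k vertices (X_v is nonempty and k ≥ 2).
    clique-v-share : k ≤ count atV S
    clique-v-share with 1 ≤? count atV S
    ... | yes meets =
      let (u , u∈S , u∈Xv) = count-witness atV S meets in
      ≤-trans (nbrs-at-v u u∈Xv) (count-remove-∈ atV u S u∈S u∈Xv)
    ... | no misses = ⊥-elim (2≰1 (≤-trans two≤k k≤1))
      where
      i₀ : Fin m
      i₀ = comp v
      some-u : Σ (VG i₀) λ x → x ∈ clique-v i₀ × T true
      some-u = count-witness (λ _ → true) (clique-v i₀)
                 (subst (1 ≤_) (sym (trans (count-true (clique-v i₀)) (length-clique-v i₀))) (≤-trans (s≤s z≤n) (v-deg i₀)))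
      u : VF
      u = ι i₀ (proj₁ some-u)
      k≤1 : k ≤ 1
      k≤1 = begin
        k                             ≤⟨ nbrs-at-v u (All.lookup (all-at-v i₀) (proj₁ (proj₂ some-u))) ⟩
        count (atV ∖ u) S + 1         ≤⟨ +-monoˡ-≤ 1 (count-mono (λ y → proj₁ ∘ to (T-∧ {atV y})) S) ⟩
        count atV S + 1               ≤⟨ +-monoˡ-≤ 1 (≤-pred (≰⇒> misses)) ⟩
        1                             ∎
        where open ≤-Reasoning

    -- Component i: restrict S to (G i)_I and complete its part in X_v to k+1 vertices.
    module Component (i : Fin m) where
      open Removal (_≟G_ {i}) using () renaming (_∖_ to _∖ᵢ_; count-remove to count-removeᵢ)

      Sᵢ : List (VG i)
      Sᵢ = restrict-to i S

      atVᵢ : VG i → Bool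
      atVᵢ = atV ∘ ι i

      sᵢ : ℕ
      sᵢ = count atVᵢ Sᵢ

      unique-Sᵢ : Unique Sᵢ
      unique-Sᵢ = unique-filterMap (λ x → tag x FinP.≟ i) (lift i) (λ x y _ _ eq → cong (ι i) eq) S (proj₁ tds)

      open Augment (_≟G_ {i}) atVᵢ (suc k) using (Enlargement; augment)

      completion : Enlargement Sᵢ
      completion = augment (clique-v i) Sᵢ (unique-clique-v i) (all-at-v i)
                           (subst (suc k ≤_) (sym (length-clique-v i)) (v-deg i)) unique-Sᵢ

      R : List (VG i)
      R = proj₁ completion ++ Sᵢ

      size : length R ≤ length Sᵢ + (suc k ∸ sᵢ)
      size = begin
        length R                              ≡⟨ length-++ (proj₁ completion) ⟩
        length (proj₁ completion) + length Sᵢ ≤⟨ +-monoˡ-≤ (length Sᵢ) (proj₁ (proj₂ completion)) ⟩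
        (suc k ∸ sᵢ) + length Sᵢ              ≡⟨ +-comm (suc k ∸ sᵢ) (length Sᵢ) ⟩
        length Sᵢ + (suc k ∸ sᵢ)              ∎
        where open ≤-Reasoning

      R-TDS : IsKTupleTDS (Inflate (G i)) k R
      R-TDS = proj₁ (proj₂ (proj₂ completion)) , λ x' → dominated x' (T? (atVᵢ x'))
        where
        -- A vertex of X_v is adjacent to the other ≥ k vertices of R in X_v; any other vertex is
        -- dominated by S already, since all its neighbours in F_I lie in component i.
        dominated : ∀ x' → Dec (T (atVᵢ x')) → k ≤ count (EG i x') R
        dominated x' (yes x'∈Xv) = begin
          k                            ≤⟨ +-cancelʳ-≤ 1 k _ (≤-trans (subst (_≤ count atVᵢ R) (+-comm 1 k) (proj₂ (proj₂ (proj₂ completion))))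
                                                                       (count-removeᵢ atVᵢ x' R (proj₁ (proj₂ (proj₂ completion))))) ⟩
          count (atVᵢ ∖ᵢ x') R         ≤⟨ count-mono (λ y y∈ → let (y∈Xv , y≢x') = to (T-∧ {atVᵢ y}) y∈ in
                                                          clique-v-adj x' y x'∈Xv y∈Xv (toWitnessFalse y≢x')) R ⟩
          count (EG i x') R            ∎
          where open ≤-Reasoning
        dominated x'@(((a , _) , (b , _)) , e) (no x'∉Xv) = begin
          k                                                   ≤⟨ proj₂ tds (ι i x') ⟩
          count (EF (ι i x')) S                               ≤⟨ count-mono nbrs-in-i S ⟩
          count (λ y → ⌊ tag y FinP.≟ i ⌋ ∧ EF (ι i x') y) S   ≡⟨ count-restrict i (EG i x') (EF (ι i x')) (λ y p → ι-adj i x' (lift i y p)) S ⟨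
          count (EG i x') Sᵢ                                  ≤⟨ m≤n+m _ _ ⟩
          count (EG i x') (proj₁ completion) + count (EG i x') Sᵢ ≡⟨ count-++ (EG i x') (proj₁ completion) Sᵢ ⟨
          count (EG i x') R                                   ∎
          where
          open ≤-Reasoning
          nbrs-in-i : ∀ y → T (EF (ι i x') y) → T (⌊ tag y FinP.≟ i ⌋ ∧ EF (ι i x') y)
          nbrs-in-i y x~y = from (T-∧ {⌊ tag y FinP.≟ i ⌋}) (fromWitness (trans (tag-adj {a} {b} {e} y (x'∉Xv ∘ fromWitness) x~y) (tag-ι x')) , x~y)

    open Component using (Sᵢ; sᵢ; R; R-TDS; size)

    length-pieces : sumFin (length ∘ Sᵢ) ≡ length S
    length-pieces = begin
      sumFin (length ∘ Sᵢ)                                        ≡⟨ sumFin-cong (λ i → trans (sym (count-true (Sᵢ i))) (count-restrict i _ _ (λ _ _ → refl) S)) ⟩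
      sumFin (λ i → count (λ x → ⌊ tag x FinP.≟ i ⌋ ∧ true) S)   ≡⟨ partition tag (λ _ → true) S ⟩
      count (λ _ → true) S                                        ≡⟨ count-true S ⟩
      length S                                                    ∎
      where open ≡-Reasoning

    at-v-pieces : sumFin sᵢ ≡ count atV S
    at-v-pieces = trans (sumFin-cong (λ i → count-restrict i (atV ∘ ι i) atV (λ _ _ → refl) S)) (partition tag atV S)

    bound : (c : Fin m → ℕ) → (∀ i R → IsKTupleTDS (Inflate (G i)) k R → c i ≤ length R) →
            sumFin c + k ≤ length S + m * (k + 1)
    bound c minimal = begin
      sumFin c + k                                                   ≤⟨ +-monoˡ-≤ k (sumFin-mono λ i → ≤-trans (minimal i (R i) (R-TDS i)) (size i)) ⟩
      sumFin (λ i → length (Sᵢ i) + (suc k ∸ sᵢ i)) + k              ≡⟨ cong (_+ k) (sumFin-+ (length ∘ Sᵢ) (λ i → suc k ∸ sᵢ i)) ⟩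
      sumFin (length ∘ Sᵢ) + sumFin (λ i → suc k ∸ sᵢ i) + k         ≡⟨ +-assoc (sumFin (length ∘ Sᵢ)) _ k ⟩
      sumFin (length ∘ Sᵢ) + (sumFin (λ i → suc k ∸ sᵢ i) + k)       ≤⟨ +-mono-≤ (≤-reflexive length-pieces)
                                                                         (deficit-bound sᵢ k (subst (k ≤_) (sym at-v-pieces) clique-v-share)) ⟩
      length S + m * suc k                                           ≡⟨ cong (λ t → length S + m * t) (+-comm 1 k) ⟩
      length S + m * (k + 1)                                         ∎
      where open ≤-Reasoning

  lower-bound : ∀ {k} → 2 ≤ k → (∀ i → k < degIn F (inComp v comp i) v) → (c : Fin m → ℕ) (cF : ℕ) →
                (∀ i → IsGammaKT (Inflate (G i)) k (c i)) → IsGammaKT (Inflate (AsGr F)) k cF →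
                sumFin c + k ≤ cF + m * (k + 1)
  lower-bound two≤k v-deg c cF γG ((S , tds , |S|≡cF) , _) =
    subst (λ s → sumFin c + _ ≤ s + m * (_ + 1)) |S|≡cF
          (LowerBound.bound two≤k v-deg S tds c (λ i → proj₂ (γG i)))

bounds : (n : ℕ) (F : SimpleGraph n) (v : Fin n) (m : ℕ) (comp : Fin n → Fin m) (k : ℕ) →
         Hyp F v m comp k → (c : Fin m → ℕ) (cF : ℕ) →
         (∀ i → IsGammaKT (Inflate (vComponent F v comp i)) k (c i)) → IsGammaKT (Inflate (AsGr F)) k cF →
         (sumFin c + k ≤ cF + m * (k + 1)) × (cF ≤ sumFin c)
bounds n F v m comp k hyp c cF γG γF =
  lower-bound (Hyp.two≤k hyp) (λ i → Hyp.k<δ hyp i v (in-component (inj₁ refl))) c cF γG γF ,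
  upper-bound c cF γG γF
  where open CutVertex F v comp (VComponents.separated (Hyp.comps hyp))

module Walks {n} (F : SimpleGraph n) {P : Fin n → Bool} where

  walk-head : ∀ {x y} → Walk F P x y → T (P x)
  walk-head (stay px)     = px
  walk-head (step px _ _) = px

  walk-++ : ∀ {x y z} → Walk F P x y → Walk F P y z → Walk F P x z
  walk-++ (stay _)       w' = w'
  walk-++ (step px e w)  w' = step px e (walk-++ w w')

  walk-reverse : ∀ {x y} → Walk F P x y → Walk F P y x
  walk-reverse (stay px) = stay px
  walk-reverse {x} (step {y = y} px e w) =
    walk-++ (walk-reverse w) (step (walk-head w) (subst T (SimpleGraph.sym F x y) e) (stay px))

  via-hub : ∀ h → (∀ z → T (P z) → Walk F P z h) → ∀ x y → T (P x) → T (P y) → Walk F P x y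
  via-hub h to-hub x y px py = walk-++ (to-hub x px) (walk-reverse (to-hub y py))

  Near : Fin n → Fin n → Set
  Near h z = z ≡ h ⊎ T (adj F z h) ⊎ Σ (Fin n) λ w → T (P w) × T (adj F z w) × T (adj F w h)

  near? : ∀ h z → Dec (Near h z)
  near? h z = z FinP.≟ h ⊎-dec (T? (adj F z h) ⊎-dec FinP.any? λ w → T? (P w) ×-dec (T? (adj F z w) ×-dec T? (adj F w h)))

  walk-from-near : ∀ {h z} → T (P h) → T (P z) → Near h z → Walk F P z h
  walk-from-near ph pz (inj₁ refl)                      = stay pz
  walk-from-near ph pz (inj₂ (inj₁ e))                  = step pz e (stay ph)
  walk-from-near ph pz (inj₂ (inj₂ (w , pw , e , e'))) = step pz e (step pw e' (stay ph))

walk-within-class : ∀ {n m} {F : SimpleGraph n} {v : Fin n} (comp : Fin n → Fin m) →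
                    (∀ x y → x ≢ v → y ≢ v → T (adj F x y) → comp x ≡ comp y) →
                    ∀ {x y} → Walk F (notV v) x y → comp x ≡ comp y
walk-within-class comp separated (stay _) = refl
walk-within-class {F = F} {v} comp separated {x} (step {y = y} px e w) =
  trans (separated x y (toWitnessFalse px) (toWitnessFalse (Walks.walk-head F w)) e) (walk-within-class comp separated w)

Searchable : Set → Set₁
Searchable A = ∀ {P : A → Set} → (∀ x → Dec (P x)) → Dec (∀ x → P x)

search-Fin : ∀ {n} → Searchable (Fin n)
search-Fin = FinP.all?

search-T : ∀ b → Searchable (T b)
search-T true  P? = map′ (λ p _ → p) (λ f → f tt) (P? tt)
search-T false P? = yes λ ()

search-Σ : ∀ {A : Set} {B : A → Set} → Searchable A → (∀ a → Searchable (B a)) → Searchable (Σ A B)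
search-Σ sA sB P? = map′ (λ f (a , b) → f a b) (λ f a b → f (a , b)) (sA λ a → sB a λ b → P? (a , b))

search-IV : ∀ {G : Gr} → Searchable (V G) → Searchable (IV G)
search-IV {G} sV = search-Σ (search-Σ sV (λ _ → sV)) (λ (a , b) → search-T (E G a b))

by-decision : ∀ {A : Set} (a? : Dec A) → {True a?} → A
by-decision a? {t} = toWitness t

-- A lower bound for γ×2,t(G_I) from vertices of degree 3.  A 2-tuple total dominating set S of
-- G_I meets the clique X_x of a vertex x with neighbours a, b, c together with the two partner
-- vertices (a,x), (c,x) in at least 3 vertices; disjoint such "blocks" add up.
module DegreeThree (G : Gr) where
  open Inflated G using (vertex-≡; inflated-adj)

  Pair : Set
  Pair = V G × V G

  _≟₂_ : DecidableEquality Pair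
  _≟₂_ = ProdP.≡-dec (dec G) (dec G)

  Degree3 : V G × V G × V G × V G → Set
  Degree3 (x , a , b , c) = T (E G x a) × T (E G x b) × T (E G x c) × (∀ z → T (E G x z) → z ∈ a ∷ b ∷ c ∷ [])

  block : V G × V G × V G × V G → List Pair
  block (x , a , b , c) = (x , a) ∷ (x , b) ∷ (x , c) ∷ (a , x) ∷ (c , x) ∷ []

  clique-nbrs : ∀ x a {e : T (E G x a)} (zs : List (V G)) → (∀ z → T (E G x z) → z ≢ a → z ∈ zs) →
                ∀ y → T (IE G ((x , a) , e) y) → proj₁ y ∈ (a , x) ∷ map (x ,_) zs
  clique-nbrs x a {e} zs others ((c , d) , e') x~y with inflated-adj x a c d {e} {e'} x~y
  ... | inj₁ (refl , a≢d)  = there (∈-map⁺ (x ,_) (others d e' (a≢d ∘ sym)))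
  ... | inj₂ (refl , refl) = here refl

  module Cells (S : List (IV G)) where

    cell : Pair → ℕ
    cell c = count (λ y → ⌊ proj₁ y ≟₂ c ⌋) S

    cells : List Pair → ℕ
    cells = sum ∘ map cell

    cells-++ : ∀ L L' → cells (L ++ L') ≡ cells L + cells L'
    cells-++ L L' = trans (cong sum (map-++ cell L L')) (sum-++ (map cell L) (map cell L'))

    cell≤1 : Unique S → ∀ c → cell c ≤ 1
    cell≤1 uS c = count-≤1 _ (λ y z y≡c z≡c → pair-injective (trans (toWitness y≡c) (sym (toWitness z≡c)))) S uS
      where
      pair-injective : ∀ {y z : IV G} → proj₁ y ≡ proj₁ z → y ≡ z
      pair-injective {(a , b) , _} {(.a , .b) , _} refl = vertex-≡ refl refl

    count-≤-cells : ∀ (p : IV G → Bool) L → (∀ y → T (p y) → proj₁ y ∈ L) → count p S ≤ cells L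
    count-≤-cells p [] covered = ≤-reflexive (count-none {xs = S} (All.tabulate λ {y} _ py → case-∈[] (covered y py)))
      where
      case-∈[] : ∀ {c : Pair} → c ∈ [] → ⊥
      case-∈[] ()
    count-≤-cells p (c ∷ L) covered = begin
      count p S                                                           ≡⟨ count-split p at-c S ⟩
      count (λ y → p y ∧ at-c y) S + count (λ y → p y ∧ not (at-c y)) S   ≤⟨ +-mono-≤ (count-mono (λ y → proj₂ ∘ to (T-∧ {p y})) S)
                                                                                       (count-≤-cells _ L rest) ⟩
      cell c + cells L                                                    ∎
      where
      open ≤-Reasoning
      at-c : IV G → Bool
      at-c y = ⌊ proj₁ y ≟₂ c ⌋
      rest : ∀ y → T (p y ∧ not (at-c y)) → proj₁ y ∈ L
      rest y t with to (T-∧ {p y}) t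
      ... | py , y≢c with covered y py
      ...   | here y≡c = ⊥-elim (toWitnessFalse y≢c y≡c)
      ...   | there y∈L = y∈L

    cells-≤-count : ∀ (p : IV G → Bool) L → Unique L → (∀ y → proj₁ y ∈ L → T (p y)) → cells L ≤ count p S
    cells-≤-count p [] _ _ = z≤n
    cells-≤-count p (c ∷ L) (c∉L ∷ uL) included = begin
      cell c + cells L                                                    ≤⟨ +-mono-≤ (count-mono at-c-included S) (cells-≤-count _ L uL rest) ⟩
      count (λ y → p y ∧ at-c y) S + count (λ y → p y ∧ not (at-c y)) S   ≡⟨ count-split p at-c S ⟨
      count p S                                                           ∎
      where
      open ≤-Reasoning
      at-c : IV G → Bool
      at-c y = ⌊ proj₁ y ≟₂ c ⌋
      at-c-included : ∀ y → T (at-c y) → T (p y ∧ at-c y)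
      at-c-included y y≡c = from (T-∧ {p y}) (included y (here (toWitness y≡c)) , y≡c)
      rest : ∀ y → proj₁ y ∈ L → T (p y ∧ not (at-c y))
      rest y y∈L = from (T-∧ {p y}) (included y (there y∈L) ,
                                     fromWitnessFalse λ y≡c → All¬⇒¬Any c∉L (subst (_∈ L) y≡c y∈L))

    cells-≤-length : ∀ L → Unique L → cells L ≤ length S
    cells-≤-length L uL = subst (cells L ≤_) (count-true S) (cells-≤-count (λ _ → true) L uL (λ _ _ → tt))

    -- The three clique vertices (x,a), (x,b), (x,c) force 3 elements among the five cells of a block.
    block-arith : ∀ {A B C Pa Pb Pc} → A ≤ 1 → B ≤ 1 → C ≤ 1 → Pb ≤ 1 → Pc ≤ 1 →
                  2 ≤ Pa + (B + (C + 0)) → 2 ≤ Pb + (A + (C + 0)) → 2 ≤ Pc + (A + (B + 0)) →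
                  3 ≤ A + (B + (C + (Pa + (Pc + 0))))
    block-arith {B = B} {C} {Pa} {Pc = Pc} (s≤s z≤n) _ _ _ _ from-a _ _ =
      s≤s (≤-trans from-a (≤-trans (m≤m+n _ Pc) (≤-reflexive (reorder Pa B C Pc))))
      where
      reorder : ∀ pa b c pc → pa + (b + (c + 0)) + pc ≡ b + (c + (pa + (pc + 0)))
      reorder = solve 4 (λ pa b c pc → pa :+ (b :+ (c :+ con 0)) :+ pc := b :+ (c :+ (pa :+ (pc :+ con 0)))) refl
    block-arith z≤n _         z≤n       Pb≤1 _    _ from-b _      = ⊥-elim (2≰1 (≤-trans from-b (≤-trans (≤-reflexive (+-identityʳ _)) Pb≤1)))
    block-arith z≤n z≤n       (s≤s z≤n) _    Pc≤1 _ _      from-c = ⊥-elim (2≰1 (≤-trans from-c (≤-trans (≤-reflexive (+-identityʳ _)) Pc≤1)))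
    block-arith z≤n (s≤s z≤n) (s≤s z≤n) _    z≤n  _ _      from-c = ⊥-elim (2≰1 from-c)
    block-arith {Pa = Pa} z≤n (s≤s z≤n) (s≤s z≤n) _ (s≤s z≤n) _ _ _ = s≤s (s≤s (m≤n+m 1 Pa))

    module _ (uS : Unique S) (tds : ∀ u → 2 ≤ count (IE G u) S) where

      clique-vertex-bound : ∀ x a → (e : T (E G x a)) (zs : List (V G)) → (∀ z → T (E G x z) → z ≢ a → z ∈ zs) →
                            2 ≤ cells ((a , x) ∷ map (x ,_) zs)
      clique-vertex-bound x a e zs others = ≤-trans (tds ((x , a) , e)) (count-≤-cells _ _ (clique-nbrs x a {e} zs others))

      block-bound : ∀ w → Degree3 w → 3 ≤ cells (block w)
      block-bound (x , a , b , c) (xa , xb , xc , only) =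
        block-arith {Pa = cell (a , x)} (cell≤1 uS (x , a)) (cell≤1 uS (x , b)) (cell≤1 uS (x , c))
                    (cell≤1 uS (b , x)) (cell≤1 uS (c , x))
          (clique-vertex-bound x a xa (b ∷ c ∷ []) not-a)
          (clique-vertex-bound x b xb (a ∷ c ∷ []) not-b)
          (clique-vertex-bound x c xc (a ∷ b ∷ []) not-c)
        where
        not-a : ∀ z → T (E G x z) → z ≢ a → z ∈ b ∷ c ∷ []
        not-a z e z≢a with only z e
        ... | here z≡a = ⊥-elim (z≢a z≡a)
        ... | there z∈ = z∈
        not-b : ∀ z → T (E G x z) → z ≢ b → z ∈ a ∷ c ∷ []
        not-b z e z≢b with only z e
        ... | here z≡a          = here z≡a
        ... | there (here z≡b)  = ⊥-elim (z≢b z≡b)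
        ... | there (there z∈)  = there z∈
        not-c : ∀ z → T (E G x z) → z ≢ c → z ∈ a ∷ b ∷ []
        not-c z e z≢c with only z e
        ... | here z≡a                  = here z≡a
        ... | there (here z≡b)          = there (here z≡b)
        ... | there (there (here z≡c))  = ⊥-elim (z≢c z≡c)

      blocks-bound : ∀ W → All Degree3 W → 3 * length W ≤ cells (concatMap block W)
      blocks-bound []      []       = z≤n
      blocks-bound (w ∷ W) (d ∷ ds) = begin
        3 * suc (length W)                         ≡⟨ *-suc 3 (length W) ⟩
        3 + 3 * length W                           ≤⟨ +-mono-≤ (block-bound w d) (blocks-bound W ds) ⟩
        cells (block w) + cells (concatMap block W) ≡⟨ cells-++ (block w) (concatMap block W) ⟨
        cells (concatMap block (w ∷ W))            ∎
        where open ≤-Reasoning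

  degree3-lower-bound : ∀ W → All Degree3 W → Unique (concatMap block W) →
                        ∀ S → IsKTupleTDS (Inflate G) 2 S → 3 * length W ≤ length S
  degree3-lower-bound W deg3 disjoint S (uS , tds) =
    ≤-trans (Cells.blocks-bound S uS tds W deg3) (Cells.cells-≤-length S _ disjoint)

  degree3? : Searchable (V G) → ∀ w → Dec (Degree3 w)
  degree3? search (x , a , b , c) =
    T? (E G x a) ×-dec (T? (E G x b) ×-dec (T? (E G x c) ×-dec search λ z → T? (E G x z) →-dec (z ∈? a ∷ b ∷ c ∷ [])))
    where open DecMembership (dec G) using (_∈?_)

-- F consists of two copies of the graph on {0,…,5} with edges 01 02 03 04 13 15 24 25
-- 35 45 (minimum degree 3) glued at the cut vertex 0, and k = 2.  Each v-component has
-- γ×2,t = 12 and F has γ×2,t = 24: the arcs (both orientations) of a Hamiltonian cycle of a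
-- v-component form a 2-tuple total dominating set of its inflation, and the four (resp. eight)
-- degree-3 vertices other than 0 and 5, 10 give the matching lower bounds.
module Example where

  edges : List (Fin 11 × Fin 11)
  edges = (# 0 , # 1) ∷ (# 0 , # 2) ∷ (# 0 , # 3) ∷ (# 0 , # 4) ∷ (# 1 , # 3) ∷ (# 1 , # 5) ∷ (# 2 , # 4)
        ∷ (# 2 , # 5) ∷ (# 3 , # 5) ∷ (# 4 , # 5)
        ∷ (# 0 , # 6) ∷ (# 0 , # 7) ∷ (# 0 , # 8) ∷ (# 0 , # 9) ∷ (# 6 , # 8) ∷ (# 6 , # 10) ∷ (# 7 , # 9)
        ∷ (# 7 , # 10) ∷ (# 8 , # 10) ∷ (# 9 , # 10) ∷ []

  _≟ₑ_ : DecidableEquality (Fin 11 × Fin 11)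
  _≟ₑ_ = ProdP.≡-dec FinP._≟_ FinP._≟_

  open DecMembership _≟ₑ_ using (_∈?_)

  joined : Fin 11 → Fin 11 → Bool
  joined a b = ⌊ (a , b) ∈? edges ⌋ ∨ ⌊ (b , a) ∈? edges ⌋

  F : SimpleGraph 11
  F = record
    { adj    = joined
    ; sym    = λ a b → ∨-comm ⌊ (a , b) ∈? edges ⌋ ⌊ (b , a) ∈? edges ⌋
    ; irrefl = by-decision (search-Fin λ x → joined x x Bool.≟ false) }

  v : Fin 11
  v = # 0

  comp : Fin 11 → Fin 2
  comp x = if ⌊ Fin.toℕ x ≤? 5 ⌋ then # 0 else # 1

  separated : ∀ x y → x ≢ v → y ≢ v → T (adj F x y) → comp x ≡ comp y
  separated = by-decision (search-Fin λ x → search-Fin λ y →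
                ¬? (x FinP.≟ v) →-dec (¬? (y FinP.≟ v) →-dec (T? (adj F x y) →-dec comp x FinP.≟ comp y)))

  -- Each class of F - v is within distance two of a hub inside the class; F itself of the vertex 0.
  hub : Fin 2 → Fin 11
  hub Fin.zero    = # 5
  hub (Fin.suc _) = # 10

  in-class : Fin 2 → Fin 11 → Bool
  in-class i z = notV v z ∧ ⌊ comp z FinP.≟ i ⌋

  in-class-intro : ∀ {i x} → x ≢ v → comp x ≡ i → T (in-class i x)
  in-class-intro {x = x} x≢v cx≡i = from (T-∧ {notV v x}) (fromWitnessFalse x≢v , fromWitness cx≡i)

  near-hub : ∀ i z → T (in-class i z) → Walks.Near F {in-class i} (hub i) z
  near-hub = by-decision (search-Fin λ i → search-Fin λ z → T? (in-class i z) →-dec Walks.near? F (hub i) z)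

  near-0 : ∀ z → Walks.Near F {λ _ → true} v z
  near-0 = by-decision (search-Fin (Walks.near? F v))

  connected : Connected F
  connected x y = via-hub v (λ z _ → walk-from-near tt tt (near-0 z)) x y tt tt
    where open Walks F

  components : VComponents F v 2 comp
  components = record { nonempty = nonempty ; connected = connected-in-class ; separated = separated }
    where
    nonempty : ∀ i → Σ[ x ∈ Fin 11 ] x ≢ v × comp x ≡ i
    nonempty Fin.zero           = # 1 , (λ ()) , refl
    nonempty (Fin.suc Fin.zero) = # 6 , (λ ()) , refl
    hub-in-class : ∀ i → T (in-class i (hub i))
    hub-in-class Fin.zero           = tt
    hub-in-class (Fin.suc Fin.zero) = tt
    connected-in-class : ∀ x y → x ≢ v → y ≢ v → comp x ≡ comp y → Walk F (in-class (comp x)) x y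
    connected-in-class x y x≢v y≢v cx≡cy =
      via-hub (hub i) (λ z pz → walk-from-near (hub-in-class i) pz (near-hub i z pz)) x y
              (in-class-intro x≢v refl) (in-class-intro y≢v (sym cx≡cy))
      where
      open Walks F
      i : Fin 2
      i = comp x

  cut : IsCutVertex F v
  cut = # 1 , # 6 , (λ ()) , (λ ()) , λ w → 0≢1 (walk-within-class comp separated w)
    where
    0≢1 : Fin.zero ≢ Fin.suc Fin.zero
    0≢1 ()

  degrees : ∀ i x → T (inComp v comp i x) → 2 < degIn F (inComp v comp i) x
  degrees = by-decision (search-Fin λ i → search-Fin λ x → T? (inComp v comp i x) →-dec (2 <? degIn F (inComp v comp i) x))

  hyp : Hyp F v 2 comp 2
  hyp = record { conn = connected ; cut = cut ; comps = components ; two≤k = ≤-refl ; k<δ = degrees }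

  G : Fin 2 → Gr
  G = vComponent F v comp

  search-V : ∀ i → Searchable (V (G i))
  search-V i = search-Σ search-Fin (λ a → search-T (inComp v comp i a))

  pt : ∀ {i} (a : Fin 11) {pa : T (inComp v comp i a)} → V (G i)
  pt a {pa} = a , pa

  arc : ∀ {i} (a b : Fin 11) {pa : T (inComp v comp i a)} {pb : T (inComp v comp i b)} {e : T (adj F a b)} → IV (G i)
  arc a b {pa} {pb} {e} = ((a , pa) , (b , pb)) , e

  is-2TDS? : ∀ i (S : List (IV (G i))) → Dec (IsKTupleTDS (Inflate (G i)) 2 S)
  is-2TDS? i S = unique? S ×-dec search-IV {G i} (search-V i) (λ x → 2 ≤? count (IE (G i) x) S)
    where open UniqueDec (dec (Inflate (G i))) using (unique?)

  -- arcs of the Hamiltonian cycles 0 1 3 5 2 4 and 0 6 8 10 7 9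
  cycle-arcs : ∀ i → List (IV (G i))
  cycle-arcs Fin.zero =
    arc (# 0) (# 1) ∷ arc (# 1) (# 0) ∷ arc (# 1) (# 3) ∷ arc (# 3) (# 1) ∷ arc (# 3) (# 5) ∷ arc (# 5) (# 3) ∷
    arc (# 5) (# 2) ∷ arc (# 2) (# 5) ∷ arc (# 2) (# 4) ∷ arc (# 4) (# 2) ∷ arc (# 4) (# 0) ∷ arc (# 0) (# 4) ∷ []
  cycle-arcs (Fin.suc Fin.zero) =
    arc (# 0) (# 6) ∷ arc (# 6) (# 0) ∷ arc (# 6) (# 8) ∷ arc (# 8) (# 6) ∷ arc (# 8) (# 10) ∷ arc (# 10) (# 8) ∷
    arc (# 10) (# 7) ∷ arc (# 7) (# 10) ∷ arc (# 7) (# 9) ∷ arc (# 9) (# 7) ∷ arc (# 9) (# 0) ∷ arc (# 0) (# 9) ∷ []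

  degree3-vertices : ∀ i → List (V (G i) × V (G i) × V (G i) × V (G i))
  degree3-vertices Fin.zero =
    (pt (# 1) , pt (# 0) , pt (# 3) , pt (# 5)) ∷ (pt (# 2) , pt (# 0) , pt (# 4) , pt (# 5)) ∷
    (pt (# 3) , pt (# 0) , pt (# 1) , pt (# 5)) ∷ (pt (# 4) , pt (# 0) , pt (# 2) , pt (# 5)) ∷ []
  degree3-vertices (Fin.suc Fin.zero) =
    (pt (# 6) , pt (# 0) , pt (# 8) , pt (# 10)) ∷ (pt (# 7) , pt (# 0) , pt (# 9) , pt (# 10)) ∷
    (pt (# 8) , pt (# 0) , pt (# 6) , pt (# 10)) ∷ (pt (# 9) , pt (# 0) , pt (# 7) , pt (# 10)) ∷ []

  blocks-ok? : (H : Gr) → Searchable (V H) → ∀ W → Dec (All (DegreeThree.Degree3 H) W × Unique (concatMap (DegreeThree.block H) W))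
  blocks-ok? H search W = All.all? (degree3? search) W ×-dec unique? (concatMap block W)
    where
    open DegreeThree H using (degree3?; block; _≟₂_)
    open UniqueDec _≟₂_ using (unique?)

  twelve : ∀ i → length (cycle-arcs i) ≡ 12 → length (degree3-vertices i) ≡ 4 →
           IsKTupleTDS (Inflate (G i)) 2 (cycle-arcs i) →
           All (DegreeThree.Degree3 (G i)) (degree3-vertices i) × Unique (concatMap (DegreeThree.block (G i)) (degree3-vertices i)) →
           IsGammaKT (Inflate (G i)) 2 12
  twelve i |S|≡12 |W|≡4 tds (deg3 , disjoint) =
    (cycle-arcs i , tds , |S|≡12) ,
    λ S S-tds → subst (_≤ length S) (cong (3 *_) |W|≡4)
                      (DegreeThree.degree3-lower-bound (G i) (degree3-vertices i) deg3 disjoint S S-tds)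

  γ-component : ∀ i → IsGammaKT (Inflate (G i)) 2 12
  γ-component Fin.zero = twelve Fin.zero refl refl
    (by-decision (is-2TDS? _ (cycle-arcs Fin.zero)))
    (by-decision (blocks-ok? (G _) (search-V _) (degree3-vertices Fin.zero)))
  γ-component (Fin.suc Fin.zero) = twelve (Fin.suc Fin.zero) refl refl
    (by-decision (is-2TDS? _ (cycle-arcs (Fin.suc Fin.zero))))
    (by-decision (blocks-ok? (G _) (search-V _) (degree3-vertices (Fin.suc Fin.zero))))

  F-degree3-vertices : List (Fin 11 × Fin 11 × Fin 11 × Fin 11)
  F-degree3-vertices =
    (# 1 , # 0 , # 3 , # 5) ∷ (# 2 , # 0 , # 4 , # 5) ∷ (# 3 , # 0 , # 1 , # 5) ∷ (# 4 , # 0 , # 2 , # 5) ∷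
    (# 6 , # 0 , # 8 , # 10) ∷ (# 7 , # 0 , # 9 , # 10) ∷ (# 8 , # 0 , # 6 , # 10) ∷ (# 9 , # 0 , # 7 , # 10) ∷ []

  open CutVertex F v comp separated using (module Gluing)
  open Gluing (λ i → proj₁ (proj₁ (γ-component i))) (λ i → proj₁ (proj₂ (proj₁ (γ-component i)))) using (glued; glued-TDS)

  γ-F : IsGammaKT (Inflate (AsGr F)) 2 24
  γ-F = (glued , glued-TDS , refl) ,
        DegreeThree.degree3-lower-bound (AsGr F) F-degree3-vertices (proj₁ blocks-ok) (proj₂ blocks-ok)
    where
    blocks-ok : All (DegreeThree.Degree3 (AsGr F)) F-degree3-vertices ×
                Unique (concatMap (DegreeThree.block (AsGr F)) F-degree3-vertices)
    blocks-ok = by-decision (blocks-ok? (AsGr F) search-Fin F-degree3-vertices)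

  sharp : Σ[ n ∈ ℕ ] Σ[ F ∈ SimpleGraph n ] Σ[ v ∈ Fin n ] Σ[ m ∈ ℕ ] Σ[ comp ∈ (Fin n → Fin m) ] Σ[ k ∈ ℕ ]
            Hyp F v m comp k ×
            (Σ[ c ∈ (Fin m → ℕ) ] Σ[ cF ∈ ℕ ]
              (∀ i → IsGammaKT (Inflate (vComponent F v comp i)) k (c i)) ×
              IsGammaKT (Inflate (AsGr F)) k cF ×
              cF ≡ sumFin c)
  sharp = 11 , F , v , 2 , comp , 2 , hyp , (λ _ → 12) , 24 , γ-component , γ-F , refl

theorem3p6 : ((n : ℕ) (F : SimpleGraph n) (v : Fin n) (m : ℕ) (comp : Fin n → Fin m) (k : ℕ) →
    Hyp F v m comp k →
    (c : Fin m → ℕ) (cF : ℕ) →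
    (∀ i → IsGammaKT (Inflate (vComponent F v comp i)) k (c i)) →
    IsGammaKT (Inflate (AsGr F)) k cF →
    (sumFin c + k ≤ cF + m * (k + 1)) × (cF ≤ sumFin c))
    ×
    (Σ[ n ∈ ℕ ] Σ[ F ∈ SimpleGraph n ] Σ[ v ∈ Fin n ] Σ[ m ∈ ℕ ] Σ[ comp ∈ (Fin n → Fin m) ] Σ[ k ∈ ℕ ]
    Hyp F v m comp k ×
    (Σ[ c ∈ (Fin m → ℕ) ] Σ[ cF ∈ ℕ ]
    (∀ i → IsGammaKT (Inflate (vComponent F v comp i)) k (c i)) ×
    IsGammaKT (Inflate (AsGr F)) k cF ×
    cF ≡ sumFin c))
theorem3p6 = bounds , Example.sharp
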